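{- Under the Modified CFLS coloring $\varphi$ of $K_n$ ($n=2^{m^2}$), there are no five distinct vertices $a,b,c,d,e$ with $\varphi(ac)=\varphi(bc)$, $\varphi(ab)=\varphi(bd)$, $\varphi(ad)=\varphi(de)$ and $\varphi(ae)=\varphi(ec)$.
   Context: Let $m$ be a positive integer and $n=2^{m^2}$. The vertices of $K_n$ are the binary strings $v\in\{0,1\}^{m^2}$, written as $v=(v^{(1)},\dots,v^{(m)})$ with each block $v^{(k)}\in\{0,1\}^m$. Vertices (and blocks) are linearly ordered as binary integers: $x<y$ iff at the first bit where they differ, $x$ has 0 and $y$ has 1. For $x<y$, let $i$ be the first index with $x^{(i)}\ne y^{(i)}$; for $k\in[m]$ let $i_k$ be the first position at which the bits of $x^{(k)}$ and $y^{(k)}$ differ ($i_k=0$ if $x^{(k)}=y^{(k)}$), and let $\delta_k=+1$ if $x^{(k)}\le y^{(k)}$ and $\delta_k=-1$ if $x^{(k)}>y^{(k)}$. The Modified CFLS coloring assigns to edge $xy$ the color $\varphi(xy)=((i,\{x^{(i)},y^{(i)}\}),i_1,\dots,i_m,\delta_1,\dots,\delta_m)$. -}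

module Defs where

open import Data.Nat using (ℕ; zero; suc; _*_)
open import Data.Bool using (Bool; true; false; not; _∧_; if_then_else_)
open import Data.Vec using (Vec; []; _∷_; map; zipWith; concat; lookup)
open import Data.Fin using (Fin)
open import Data.Product using (_×_; _,_)

-- A block is a binary string of length m; a vertex of K_n (n = 2^(m²))
-- is a sequence of m blocks, i.e. a binary string of length m².
Block : ℕ → Set
Block m = Vec Bool m

Vertex : ℕ → Set
Vertex m = Vec (Block m) m

bits : ∀ {m} → Vertex m → Vec Bool (m * m)
bits = concat

lexLt : ∀ {k} → Vec Bool k → Vec Bool k → Bool
lexLt [] [] = false
lexLt (false ∷ xs) (false ∷ ys) = lexLt xs ys
lexLt (true ∷ xs) (true ∷ ys) = lexLt xs ys
lexLt (false ∷ xs) (true ∷ ys) = true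
lexLt (true ∷ xs) (false ∷ ys) = false

bEq : Bool → Bool → Bool
bEq false false = true
bEq true true = true
bEq _ _ = false

-- first (1-based) position at which two bit strings differ; 0 if equal
firstDiff : ∀ {k} → Vec Bool k → Vec Bool k → ℕ
firstDiff [] [] = 0
firstDiff (x ∷ xs) (y ∷ ys) with bEq x y
... | false = 1
... | true with firstDiff xs ys
...   | zero = zero
...   | suc j = suc (suc j)

-- first (1-based) index of a differing block; 0 if all blocks agree
firstDiffBlock : ∀ {m k} → Vec (Vec Bool k) m → Vec (Vec Bool k) m → ℕ
firstDiffBlock [] [] = 0
firstDiffBlock (x ∷ xs) (y ∷ ys) with firstDiff x y
... | suc _ = 1
... | zero with firstDiffBlock xs ys
...   | zero = zero
...   | suc j = suc (suc j)

-- the block with 1-based index i (arbitrary default if out of range)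
blockAt : ∀ {m k} → Vec (Vec Bool k) m → Vec Bool k → ℕ → Vec Bool k
blockAt [] d _ = d
blockAt (x ∷ xs) d zero = d
blockAt (x ∷ xs) d (suc zero) = x
blockAt (x ∷ xs) d (suc (suc i)) = blockAt xs d (suc i)

-- unordered pair {u, v} of blocks, represented canonically as (min, max)
unorderedPair : ∀ {k} → Vec Bool k → Vec Bool k → Vec Bool k × Vec Bool k
unorderedPair u v = if lexLt v u then (v , u) else (u , v)

-- colour type: ((i, {x^(i), y^(i)}), i_1..i_m, δ_1..δ_m)
-- δ_k is encoded as a Bool: true = +1, false = -1
Colour : ℕ → Set
Colour m = (ℕ × (Block m × Block m)) × Vec ℕ m × Vec Bool m

-- colour of the edge xy assuming x < y
colourOrd : ∀ {m} → Vertex m → Vertex m → Colour m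
colourOrd x y =
  let i = firstDiffBlock x y
      d = lookup0 x
  in (i , unorderedPair (blockAt x d i) (blockAt y d i))
     , zipWith firstDiff x y
     , zipWith (λ u v → not (lexLt v u)) x y   -- δ_k = +1 iff x^(k) ≤ y^(k)
  where
    lookup0 : ∀ {m k} → Vec (Vec Bool k) m → Vec Bool k
    lookup0 {k = k} _ = Data.Vec.replicate k false

φ : ∀ {m} → Vertex m → Vertex m → Colour m
φ x y = if lexLt (bits x) (bits y) then colourOrd x y else colourOrd y x

-- Only the first colour component (i, {x^(i), y^(i)}) matters. If the edges xz and yz receive
-- the same one, then x, z and y, z first differ at the same block i, and x^(i) = y^(i) since both
-- differ from z^(i) within one unordered pair; so x and y agree on the first i blocks and first
-- differ strictly later. At the vertex a the four colour equalities therefore make the first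
-- block where a differs from c, b, d, e, c strictly increase around a cycle.
module Submission where

open import Defs
open import Data.Nat using (ℕ; _≥_; zero; suc; _<_; s≤s; z≤n)
open import Data.Nat.Properties using (<-trans; <-irrefl; suc-injective)
open import Data.Product using (_×_; _,_; proj₁; proj₂; ∃)
open import Data.Bool using (Bool; true; false; not)
open import Data.Bool.Properties using (_≟_)
open import Data.Vec using (Vec; []; _∷_; replicate)
open import Data.Vec.Properties using (≡-dec)
open import Relation.Binary.Definitions using (DecidableEquality)
open import Relation.Binary.PropositionalEquality
open import Relation.Nullary using (¬_; yes; no; contradiction)

-- Blocks are counted from 0 here, whereas firstDiffBlock and blockAt count them from 1.
data DiffersFirstAt {A : Set} : ∀ {n} → ℕ → Vec A n → Vec A n → Set where
  here  : ∀ {n x y} {xs ys : Vec A n} → x ≢ y → DiffersFirstAt 0 (x ∷ xs) (y ∷ ys)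
  there : ∀ {n i x} {xs ys : Vec A n} → DiffersFirstAt i xs ys → DiffersFirstAt (suc i) (x ∷ xs) (x ∷ ys)

module _ {A : Set} where

  ≢⇒differsFirstAt : DecidableEquality A → ∀ {n} {xs ys : Vec A n} → xs ≢ ys → ∃ λ i → DiffersFirstAt i xs ys
  ≢⇒differsFirstAt _≟ᴬ_ {xs = []} {[]} []≢[] = contradiction refl []≢[]
  ≢⇒differsFirstAt _≟ᴬ_ {xs = x ∷ xs} {y ∷ ys} x∷xs≢y∷ys with x ≟ᴬ y
  ... | no x≢y = 0 , here x≢y
  ... | yes refl with ≢⇒differsFirstAt _≟ᴬ_ (λ xs≡ys → x∷xs≢y∷ys (cong (x ∷_) xs≡ys))
  ...   | i , p = suc i , there p

  differsFirstAt-sym : ∀ {n i} {xs ys : Vec A n} → DiffersFirstAt i xs ys → DiffersFirstAt i ys xs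
  differsFirstAt-sym (here x≢y) = here (≢-sym x≢y)
  differsFirstAt-sym (there p)  = there (differsFirstAt-sym p)

module _ {k : ℕ} {d : Vec Bool k} where

  differsFirstAt⇒blockAt≢ : ∀ {m i} {xs ys : Vec (Vec Bool k) m} → DiffersFirstAt i xs ys →
                            blockAt xs d (suc i) ≢ blockAt ys d (suc i)
  differsFirstAt⇒blockAt≢ (here x≢y) = x≢y
  differsFirstAt⇒blockAt≢ (there p)  = differsFirstAt⇒blockAt≢ p

  differsFirstAt-blockAt≡⇒< : ∀ {m i j} {xs ys zs : Vec (Vec Bool k) m} →
                              DiffersFirstAt i xs zs → DiffersFirstAt i ys zs →
                              blockAt xs d (suc i) ≡ blockAt ys d (suc i) →
                              DiffersFirstAt j xs ys → i < j
  differsFirstAt-blockAt≡⇒< (here _)  (here _)  x≡y (here x≢y) = contradiction x≡y x≢y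
  differsFirstAt-blockAt≡⇒< (here _)  (here _)  _   (there _)  = s≤s z≤n
  differsFirstAt-blockAt≡⇒< (there _) (there _) _   (here x≢x) = contradiction refl x≢x
  differsFirstAt-blockAt≡⇒< (there p) (there q) x≡y (there r)  = s≤s (differsFirstAt-blockAt≡⇒< p q x≡y r)

_≟ᵇ_ : ∀ {k} → DecidableEquality (Vec Bool k)
_≟ᵇ_ = ≡-dec _≟_

firstDiff-refl : ∀ {k} (xs : Vec Bool k) → firstDiff xs xs ≡ 0
firstDiff-refl []           = refl
firstDiff-refl (false ∷ xs) rewrite firstDiff-refl xs = refl
firstDiff-refl (true ∷ xs)  rewrite firstDiff-refl xs = refl

firstDiff≡0⇒≡ : ∀ {k} {xs ys : Vec Bool k} → firstDiff xs ys ≡ 0 → xs ≡ ys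
firstDiff≡0⇒≡ {xs = []} {[]} _ = refl
firstDiff≡0⇒≡ {xs = false ∷ xs} {false ∷ ys} _ with firstDiff xs ys in tail≡0
firstDiff≡0⇒≡ {xs = false ∷ xs} {false ∷ ys} _ | zero = cong (false ∷_) (firstDiff≡0⇒≡ tail≡0)
firstDiff≡0⇒≡ {xs = true ∷ xs} {true ∷ ys} _ with firstDiff xs ys in tail≡0
firstDiff≡0⇒≡ {xs = true ∷ xs} {true ∷ ys} _ | zero = cong (true ∷_) (firstDiff≡0⇒≡ tail≡0)
firstDiff≡0⇒≡ {xs = false ∷ xs} {true ∷ ys} ()
firstDiff≡0⇒≡ {xs = true ∷ xs} {false ∷ ys} ()

module _ {k : ℕ} where

  differsFirstAt⇒firstDiffBlock : ∀ {m i} {xs ys : Vec (Vec Bool k) m} → DiffersFirstAt i xs ys →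
                                  firstDiffBlock xs ys ≡ suc i
  differsFirstAt⇒firstDiffBlock {xs = x ∷ _} {y ∷ _} (here x≢y) with firstDiff x y in diff
  ... | zero  = contradiction (firstDiff≡0⇒≡ diff) x≢y
  ... | suc _ = refl
  differsFirstAt⇒firstDiffBlock {xs = x ∷ _} (there p)
    rewrite firstDiff-refl x | differsFirstAt⇒firstDiffBlock p = refl

  firstDiffBlock-comm : ∀ {m} (xs ys : Vec (Vec Bool k) m) → firstDiffBlock xs ys ≡ firstDiffBlock ys xs
  firstDiffBlock-comm xs ys with ≡-dec _≟ᵇ_ xs ys
  ... | yes refl  = refl
  ... | no xs≢ys with ≢⇒differsFirstAt _≟ᵇ_ xs≢ys
  ...   | _ , p = trans (differsFirstAt⇒firstDiffBlock p)
                        (sym (differsFirstAt⇒firstDiffBlock (differsFirstAt-sym p)))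

lexLt-flip : ∀ {k} {u v : Vec Bool k} → u ≢ v → lexLt u v ≡ not (lexLt v u)
lexLt-flip {u = []}         {[]}         []≢[] = contradiction refl []≢[]
lexLt-flip {u = false ∷ us} {false ∷ vs} u≢v   = lexLt-flip (λ us≡vs → u≢v (cong (false ∷_) us≡vs))
lexLt-flip {u = true ∷ us}  {true ∷ vs}  u≢v   = lexLt-flip (λ us≡vs → u≢v (cong (true ∷_) us≡vs))
lexLt-flip {u = false ∷ _}  {true ∷ _}   _     = refl
lexLt-flip {u = true ∷ _}   {false ∷ _}  _     = refl

unorderedPair-comm : ∀ {k} (u v : Vec Bool k) → unorderedPair u v ≡ unorderedPair v u
unorderedPair-comm u v with u ≟ᵇ v
... | yes refl = refl
... | no u≢v rewrite lexLt-flip u≢v with lexLt v u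
...   | true  = refl
...   | false = refl

unorderedPair-cancelʳ : ∀ {k} {u v w : Vec Bool k} → u ≢ w → v ≢ w →
                        unorderedPair u w ≡ unorderedPair v w → u ≡ v
unorderedPair-cancelʳ {u = u} {v} {w} u≢w v≢w eq with lexLt w u | lexLt w v
... | true  | true  = cong proj₂ eq
... | false | false = cong proj₁ eq
... | true  | false = contradiction (sym (cong proj₁ eq)) v≢w
... | false | true  = contradiction (cong proj₁ eq) u≢w

module _ {m : ℕ} where

  colourOrd-proj₁-comm : (x y : Vertex m) → proj₁ (colourOrd x y) ≡ proj₁ (colourOrd y x)
  colourOrd-proj₁-comm x y rewrite firstDiffBlock-comm x y = cong (firstDiffBlock y x ,_) (unorderedPair-comm _ _)

  φ-proj₁ : (x y : Vertex m) → proj₁ (φ x y) ≡ proj₁ (colourOrd x y)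
  φ-proj₁ x y with lexLt (bits x) (bits y)
  ... | true  = refl
  ... | false = colourOrd-proj₁-comm y x

  φ-proj₁-comm : (x y : Vertex m) → proj₁ (φ x y) ≡ proj₁ (φ y x)
  φ-proj₁-comm x y = trans (φ-proj₁ x y) (trans (colourOrd-proj₁-comm x y) (sym (φ-proj₁ y x)))

  colourOrd-proj₁-differsFirstAt : ∀ {i} {x y : Vertex m} → DiffersFirstAt i x y →
    proj₁ (colourOrd x y) ≡ (suc i , unorderedPair (blockAt x (replicate m false) (suc i))
                                                    (blockAt y (replicate m false) (suc i)))
  colourOrd-proj₁-differsFirstAt p rewrite differsFirstAt⇒firstDiffBlock p = refl

  φ-proj₁-differsFirstAt : ∀ {i} {x y : Vertex m} → DiffersFirstAt i x y →
    proj₁ (φ x y) ≡ (suc i , unorderedPair (blockAt x (replicate m false) (suc i))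
                                            (blockAt y (replicate m false) (suc i)))
  φ-proj₁-differsFirstAt {x = x} {y} p = trans (φ-proj₁ x y) (colourOrd-proj₁-differsFirstAt p)

  φ-proj₁≡⇒firstDiffBlock< : {x y z : Vertex m} → x ≢ y → x ≢ z → y ≢ z →
                             proj₁ (φ x z) ≡ proj₁ (φ y z) → firstDiffBlock x z < firstDiffBlock x y
  φ-proj₁≡⇒firstDiffBlock< {x} {y} x≢y x≢z y≢z φxz≡φyz
    with ≢⇒differsFirstAt _≟ᵇ_ x≢z | ≢⇒differsFirstAt _≟ᵇ_ y≢z | ≢⇒differsFirstAt _≟ᵇ_ x≢y
  ... | i , p | j , q | _ , r
    with trans (sym (φ-proj₁-differsFirstAt p)) (trans φxz≡φyz (φ-proj₁-differsFirstAt q))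
  ... | colours≡ with suc-injective (cong proj₁ colours≡)
  ... | refl rewrite differsFirstAt⇒firstDiffBlock p | differsFirstAt⇒firstDiffBlock r =
    s≤s (differsFirstAt-blockAt≡⇒< p q x≡y r)
    where
    x≡y : blockAt x (replicate m false) (suc i) ≡ blockAt y (replicate m false) (suc i)
    x≡y = unorderedPair-cancelʳ (differsFirstAt⇒blockAt≢ p) (differsFirstAt⇒blockAt≢ q) (cong proj₂ colours≡)

lemma9 : (m : ℕ) → m ≥ 1 → (a b c d e : Vertex m)
       → a ≢ b → a ≢ c → a ≢ d → a ≢ e → b ≢ c → b ≢ d → b ≢ e
       → c ≢ d → c ≢ e → d ≢ e
       → ¬ (φ a c ≡ φ b c × φ a b ≡ φ b d × φ a d ≡ φ d e × φ a e ≡ φ e c)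
lemma9 _ _ a b c d e a≢b a≢c a≢d a≢e b≢c b≢d _ _ c≢e d≢e (ac≡bc , ab≡bd , ad≡de , ae≡ec) =
  <-irrefl refl (<-trans ac<ab (<-trans ab<ad (<-trans ad<ae ae<ac)))
  where
  ac<ab : firstDiffBlock a c < firstDiffBlock a b
  ac<ab = φ-proj₁≡⇒firstDiffBlock< a≢b a≢c b≢c (cong proj₁ ac≡bc)

  ab<ad : firstDiffBlock a b < firstDiffBlock a d
  ab<ad = φ-proj₁≡⇒firstDiffBlock< a≢d a≢b (≢-sym b≢d) (trans (cong proj₁ ab≡bd) (φ-proj₁-comm b d))

  ad<ae : firstDiffBlock a d < firstDiffBlock a e
  ad<ae = φ-proj₁≡⇒firstDiffBlock< a≢e a≢d (≢-sym d≢e) (trans (cong proj₁ ad≡de) (φ-proj₁-comm d e))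

  ae<ac : firstDiffBlock a e < firstDiffBlock a c
  ae<ac = φ-proj₁≡⇒firstDiffBlock< a≢c a≢e c≢e (trans (cong proj₁ ae≡ec) (φ-proj₁-comm e c))
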